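{- Let $k$ and $\ell$ be integers with $k\ge 7$, $\ell\ge 10^7k^6$, such that $k$ is the smallest integer greater than $2$ that does not divide $\ell$. Let $H$ be an oriented graph such that for any vertex $x$ and any other vertex $y$ of $H$ there is a directed path of length at most $64k$ from $x$ to $y$. If for some odd $s<k$ the graph $H$ contains some orientation of a cycle of length $s$ (i.e. the underlying undirected graph of $H$ contains a cycle of length $s$), then $H$ contains a closed directed walk of length $\ell$.
   Context: An oriented graph is a directed graph obtained from a simple undirected graph by orienting each edge. A closed directed walk of length $\ell$ is a sequence of vertices $v_0,\dots,v_\ell=v_0$ (repetitions allowed) with each edge oriented from $v_{i-1}$ to $v_i$. -}

module Defs where

open import Data.Nat using (ℕ; zero; suc; _≤_; _<_)
open import Data.Nat.Divisibility using (_∣_)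
open import Data.Fin using (Fin; zero; suc; inject₁; fromℕ)
open import Data.Bool using (Bool; true; false)
open import Data.Sum using (_⊎_)
open import Data.Product using (_×_; Σ)
open import Function.Definitions using (Injective)
open import Relation.Binary.PropositionalEquality using (_≡_)
open import Relation.Nullary using (¬_)

record OrientedGraph (n : ℕ) : Set where
  field
    arc        : Fin n → Fin n → Bool
    loopless   : ∀ x → arc x x ≡ false
    asymmetric : ∀ x y → arc x y ≡ true → arc y x ≡ false
open OrientedGraph public

Arc : ∀ {n} → OrientedGraph n → Fin n → Fin n → Set
Arc H x y = arc H x y ≡ true

Adj : ∀ {n} → OrientedGraph n → Fin n → Fin n → Set
Adj H x y = Arc H x y ⊎ Arc H y x

IsDirWalk : ∀ {n} → OrientedGraph n → (m : ℕ) → (Fin (suc m) → Fin n) → Set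
IsDirWalk H m w = ∀ (i : Fin m) → Arc H (w (inject₁ i)) (w (suc i))

DirPath : ∀ {n} → OrientedGraph n → (m : ℕ) → Fin n → Fin n → Set
DirPath {n} H m x y =
  Σ (Fin (suc m) → Fin n) λ w →
    IsDirWalk H m w × Injective _≡_ _≡_ w × w zero ≡ x × w (fromℕ m) ≡ y

HasClosedDirWalk : ∀ {n} → OrientedGraph n → ℕ → Set
HasClosedDirWalk {n} H ℓ =
  Σ (Fin (suc ℓ) → Fin n) λ w → IsDirWalk H ℓ w × w zero ≡ w (fromℕ ℓ)

HasUndirectedCycle : ∀ {n} → OrientedGraph n → ℕ → Set
HasUndirectedCycle {n} H s =
  3 ≤ s ×
  Σ (Fin (suc s) → Fin n) λ c →
    (∀ (i : Fin s) → Adj H (c (inject₁ i)) (c (suc i))) ×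
    c zero ≡ c (fromℕ s) ×
    Injective _≡_ _≡_ (λ (i : Fin s) → c (inject₁ i))

Odd : ℕ → Set
Odd s = Σ ℕ λ t → s ≡ suc (2 Data.Nat.* t)

SmallestNonDivisorAbove2 : ℕ → ℕ → Set
SmallestNonDivisorAbove2 k ℓ =
  2 < k × ¬ (k ∣ ℓ) × (∀ j → 2 < j → j < k → j ∣ ℓ)

-- Walk once around the odd cycle. A forward edge is traversed directly; a
-- backward edge y → x is replaced by a directed walk P from x to y of length at
-- most 64k, and P followed by the arc y → x is a closed walk at x that can be
-- repeated any number of times. This yields closed walks of every length
-- base + t · period, where |base − period| = |forward − backward| =: d is odd
-- and less than k, hence divides ℓ. Writing ℓ = q d, the quotient q is large
-- compared with base and period, so q d is a combination of A and A + d
-- ({A, A + d} = {base, period}) with positive coefficients, and concatenating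
-- the corresponding closed walks gives one of length ℓ.
module Submission where

open import Defs
open import Data.Nat using (ℕ; zero; suc; _+_; _*_; _^_; _∸_; _≤_; _<_; z≤n; s≤s; NonZero; >-nonZero; _≤?_)
open import Data.Nat.Properties
open import Data.Nat.DivMod using (_/_; _%_; m≡m%n+[m/n]*n; m%n<n)
open import Data.Nat.Divisibility using (_∣_; divides; 1∣_)
open import Data.Nat.Tactic.RingSolver using (solve-∀)
open import Data.Fin using (Fin; zero; suc; inject₁; fromℕ)
open import Data.Sum using (_⊎_; inj₁; inj₂; [_,_]′)
open import Function using (_∘_)
open import Data.Product using (Σ; _×_; _,_)
open import Relation.Binary.PropositionalEquality
open import Relation.Nullary using (¬_; contradiction)
open import Relation.Nullary.Decidable using (toWitness)

odd-minus-even : ∀ d e {j} → d + 2 * e ≡ j → Odd j → d ≡ 1 ⊎ 2 < d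
odd-minus-even 0                 e refl (t , 2e≡1+2t)   = contradiction 2e≡1+2t (even≢odd e t)
odd-minus-even 1                 _ _    _               = inj₁ refl
odd-minus-even 2                 e refl (t , 2+2e≡1+2t) =
  contradiction (trans (*-suc 2 e) 2+2e≡1+2t) (even≢odd (suc e) t)
odd-minus-even (suc (suc (suc _))) _ _  _               = inj₂ (s≤s (s≤s (s≤s z≤n)))

same-parity∣ℓ : ∀ {k ℓ s} → SmallestNonDivisorAbove2 k ℓ → Odd s → s < k → ∀ d e → d + 2 * e ≡ s → d ∣ ℓ
same-parity∣ℓ {ℓ = ℓ} (_ , _ , small∣ℓ) s-odd s<k d e d+2e≡s with odd-minus-even d e d+2e≡s s-odd
... | inj₁ refl = 1∣ ℓ
... | inj₂ 2<d  = small∣ℓ d 2<d (≤-<-trans (≤-trans (m≤m+n d (2 * e)) (≤-reflexive d+2e≡s)) s<k)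

balance-gap : ∀ {L M f b} → L + b ≡ M + f →
  Σ ℕ λ d → Σ ℕ λ e → d + 2 * e ≡ f + b × (L ≡ M + d ⊎ M ≡ L + d)
balance-gap {L} {M} {f} {b} L+b≡M+f with ≤-total b f
... | inj₁ b≤f with d , refl ← m≤n⇒∃[o]m+o≡n b≤f =
  d , b , shuffle d b , inj₁ (+-cancelʳ-≡ b L (M + d) (trans L+b≡M+f (reorder M b d)))
  where
    shuffle : ∀ d b → d + 2 * b ≡ (b + d) + b
    shuffle = solve-∀
    reorder : ∀ M b d → M + (b + d) ≡ (M + d) + b
    reorder = solve-∀
... | inj₂ f≤b with d , refl ← m≤n⇒∃[o]m+o≡n f≤b =
  d , f , shuffle d f , inj₂ (+-cancelʳ-≡ f M (L + d) (trans (sym L+b≡M+f) (reorder L f d)))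
  where
    shuffle : ∀ d f → d + 2 * f ≡ f + (f + d)
    shuffle = solve-∀
    reorder : ∀ L f d → L + (f + d) ≡ (L + d) + f
    reorder = solve-∀

positive-combination : ∀ A d q → 1 ≤ d → suc A * A < q →
  Σ ℕ λ α → Σ ℕ λ β → 1 ≤ α × 1 ≤ β × α * A + β * (A + d) ≡ q * d
positive-combination zero d q _ 0<q = 1 , q , ≤-refl , 0<q , refl
positive-combination A@(suc _) d@(suc _) (suc q) _ A+A*A<q = α , β , 0<α , s≤s z≤n , combination≡
  where
    r = q % A
    u = q / A
    q≡r+u*A : q ≡ r + u * A
    q≡r+u*A = m≡m%n+[m/n]*n q A
    A<u : A < u
    A<u = *-cancelʳ-< A A u (+-cancelˡ-< r (A * A) (u * A) (begin-strict
      r + A * A <⟨ +-monoˡ-< (A * A) (m%n<n q A) ⟩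
      A + A * A ≤⟨ ≤-pred A+A*A<q ⟩
      q         ≡⟨ q≡r+u*A ⟩
      r + u * A ∎))
      where open ≤-Reasoning
    -- q = r + u A with r < A < u, so β = r + 1 and α = d u − β work
    β = suc r
    β<d*u : β < d * u
    β<d*u = ≤-trans (≤-trans (s≤s (m%n<n q A)) A<u) (m≤n*m u d)
    α = d * u ∸ β
    0<α : 1 ≤ α
    0<α = m<n⇒0<n∸m β<d*u
    rearrange : ∀ α β A d → α * A + β * (A + d) ≡ (α + β) * A + β * d
    rearrange = solve-∀
    collect : ∀ d u A r → d * u * A + suc r * d ≡ suc (r + u * A) * d
    collect = solve-∀
    combination≡ : α * A + β * (A + d) ≡ suc q * d
    combination≡ = begin
      α * A + β * (A + d)       ≡⟨ rearrange α β A d ⟩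
      (α + β) * A + β * d       ≡⟨ cong (λ m → m * A + β * d) (m∸n+n≡m (<⇒≤ β<d*u)) ⟩
      d * u * A + β * d         ≡⟨ collect d u A r ⟩
      suc (r + u * A) * d       ≡⟨ cong (λ m → suc m * d) q≡r+u*A ⟨
      suc q * d                 ∎
      where open ≡-Reasoning

cycle-bound : ∀ k s → s < k →
  suc (s * suc (64 * k)) * (s * suc (64 * k)) * s < 10 ^ 7 * k ^ 6
cycle-bound k s s<k = begin-strict
  suc B * B * s                     ≤⟨ *-mono-≤ (*-mono-≤ 1+B≤ B≤) (<⇒≤ s<k) ⟩
  66 * (k * k) * (65 * (k * k)) * k ≡⟨ expand k ⟩
  4290 * k ^ 5                      ≤⟨ *-monoʳ-≤ 4290 (m≤n*m (k ^ 5) k) ⟩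
  4290 * k ^ 6                      <⟨ *-monoˡ-< (k ^ 6) {{m^n≢0 k 6}} 4290<10^7 ⟩
  10 ^ 7 * k ^ 6                    ∎
  where
    open ≤-Reasoning
    instance
      k≢0 : NonZero k
      k≢0 = >-nonZero (≤-<-trans z≤n s<k)
    B = s * suc (64 * k)
    expand : ∀ k → 66 * (k * k) * (65 * (k * k)) * k ≡ 4290 * (k * (k * (k * (k * (k * 1)))))
    expand = solve-∀
    k*[1+64k]≡ : ∀ k → k * suc (64 * k) ≡ k + 64 * (k * k)
    k*[1+64k]≡ = solve-∀
    collect : ∀ x → x + 64 * x ≡ 65 * x
    collect = solve-∀
    B≤ : B ≤ 65 * (k * k)
    B≤ = begin
      s * suc (64 * k)     ≤⟨ *-monoˡ-≤ (suc (64 * k)) (<⇒≤ s<k) ⟩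
      k * suc (64 * k)     ≡⟨ k*[1+64k]≡ k ⟩
      k + 64 * (k * k)     ≤⟨ +-monoˡ-≤ (64 * (k * k)) (m≤m*n k k) ⟩
      k * k + 64 * (k * k) ≡⟨ collect (k * k) ⟩
      65 * (k * k)         ∎
    1≤k : 1 ≤ k
    1≤k = ≤-<-trans z≤n s<k
    1+B≤ : suc B ≤ 66 * (k * k)
    1+B≤ = +-mono-≤ (*-mono-≤ {1} {k} {1} {k} 1≤k 1≤k) B≤
    4290<10^7 : 4290 < 10 ^ 7
    4290<10^7 = toWitness {a? = 4291 ≤? 10 ^ 7} _

module Walks {n : ℕ} (H : OrientedGraph n) where

  infixr 5 _∷_ _++_

  data Walk : Fin n → Fin n → ℕ → Set where
    []  : ∀ {x} → Walk x x 0
    _∷_ : ∀ {x y z m} → Arc H x y → Walk y z m → Walk x z (suc m)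

  _++_ : ∀ {x y z a b} → Walk x y a → Walk y z b → Walk x z (a + b)
  []      ++ W = W
  (a ∷ V) ++ W = a ∷ (V ++ W)

  replicate : ∀ {x m} → (t : ℕ) → Walk x x m → Walk x x (t * m)
  replicate zero    W = []
  replicate (suc t) W = W ++ replicate t W

  fromIsDirWalk : ∀ m (w : Fin (suc m) → Fin n) → IsDirWalk H m w → Walk (w zero) (w (fromℕ m)) m
  fromIsDirWalk zero    w _      = []
  fromIsDirWalk (suc m) w w-walk = w-walk zero ∷ fromIsDirWalk m (λ i → w (suc i)) (λ i → w-walk (suc i))

  toIsDirWalk : ∀ {x y m} → Walk x y m →
    Σ (Fin (suc m) → Fin n) λ w → IsDirWalk H m w × w zero ≡ x × w (fromℕ m) ≡ y
  toIsDirWalk {x} []      = (λ _ → x) , (λ ()) , refl , refl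
  toIsDirWalk {x} (a ∷ W) with w , w-walk , refl , w-end ← toIsDirWalk W =
    (λ { zero → x ; (suc i) → w i }) , (λ { zero → a ; (suc i) → w-walk i }) , refl , w-end

  walk⇒HasClosedDirWalk : ∀ {x ℓ} → Walk x x ℓ → HasClosedDirWalk H ℓ
  walk⇒HasClosedDirWalk W with w , w-walk , w-start , w-end ← toIsDirWalk W =
    w , w-walk , trans w-start (sym w-end)

  Bridged : ℕ → Set
  Bridged D = ∀ {x y} → Arc H y x → Σ ℕ λ m → m ≤ D × Walk x y m

  paths⇒bridged : ∀ {D} → (∀ x y → ¬ (x ≡ y) → Σ ℕ λ m → m ≤ D × DirPath H m x y) → Bridged D
  paths⇒bridged paths {x} {y} y→x with paths x y x≢y
    where
      x≢y : ¬ (x ≡ y)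
      x≢y refl = contradiction (trans (sym y→x) (loopless H x)) λ ()
  ... | m , m≤D , w , w-walk , _ , refl , refl = m , m≤D , fromIsDirWalk m w w-walk

  record Winding (D j : ℕ) (x y : Fin n) : Set where
    field
      forward backward base period : ℕ
      edges   : forward + backward ≡ j
      balance : base + backward ≡ period + forward
      base≤   : base ≤ j * suc D
      period≤ : period ≤ j * suc D
      walks   : ∀ t → Walk x y (base + t * period)

  winding-nil : ∀ {D x} → Winding D 0 x x
  winding-nil {x = x} = record
    { forward = 0 ; backward = 0 ; base = 0 ; period = 0
    ; edges = refl ; balance = refl ; base≤ = z≤n ; period≤ = z≤n
    ; walks = λ t → subst (Walk x x) (sym (*-zeroʳ t)) [] }

  winding-forward : ∀ {D j x y z} → Arc H x y → Winding D j y z → Winding D (suc j) x z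
  winding-forward {D} {j} x→y R = record
    { forward = suc forward ; backward = backward ; base = suc base ; period = period
    ; edges   = cong suc edges
    ; balance = trans (cong suc balance) (sym (+-suc period forward))
    ; base≤   = +-mono-≤ (s≤s z≤n) base≤
    ; period≤ = ≤-trans period≤ (m≤n+m (j * suc D) (suc D))
    ; walks   = λ t → x→y ∷ walks t }
    where open Winding R

  winding-backward : ∀ {D j x y z} → Bridged D → Arc H y x → Winding D j y z → Winding D (suc j) x z
  winding-backward {D} {j} {x} {y} {z} bridged y→x R with m , m≤D , P ← bridged y→x = record
    { forward = forward ; backward = suc backward ; base = m + base ; period = suc m + period
    ; edges   = trans (+-suc forward backward) (cong suc edges)
    ; balance = balance′
    ; base≤   = +-mono-≤ (m≤n⇒m≤1+n m≤D) base≤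
    ; period≤ = +-mono-≤ (s≤s m≤D) period≤
    ; walks   = λ t → subst (Walk x z) (pumped-length t m base period)
                        (replicate t (P ++ y→x ∷ []) ++ P ++ walks t) }
    where
      open Winding R
      pumped-length : ∀ t m L M → t * (m + 1) + (m + (L + t * M)) ≡ (m + L) + t * (suc m + M)
      pumped-length = solve-∀
      balance′ : (m + base) + suc backward ≡ (suc m + period) + forward
      balance′ = begin
        (m + base) + suc backward ≡⟨ +-suc (m + base) backward ⟩
        suc ((m + base) + backward) ≡⟨ cong suc (+-assoc m base backward) ⟩
        suc (m + (base + backward)) ≡⟨ cong (λ v → suc (m + v)) balance ⟩
        suc (m + (period + forward)) ≡⟨ cong suc (+-assoc m period forward) ⟨
        (suc m + period) + forward ∎
        where open ≡-Reasoning

  winding : ∀ {D} → Bridged D → ∀ j (c : Fin (suc j) → Fin n) →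
    (∀ i → Adj H (c (inject₁ i)) (c (suc i))) → Winding D j (c zero) (c (fromℕ j))
  winding bridged zero    c adj = winding-nil
  winding bridged (suc j) c adj =
    [ winding-forward , winding-backward bridged ]′ (adj zero) (winding bridged j (c ∘ suc) (adj ∘ suc))

  pumped-walk : ∀ {x L M} → (∀ t → Walk x x (L + t * M)) → ∀ α β → Walk x x (α * M + suc β * L)
  pumped-walk {x} {L} {M} W α β = subst (Walk x x) (length≡ L M α β) (W α ++ replicate β (W 0))
    where
      length≡ : ∀ L M α β → (L + α * M) + β * (L + 0) ≡ α * M + suc β * L
      length≡ = solve-∀

  multiple-walk : ∀ {x L M d q B} → (∀ t → Walk x x (L + t * M)) → L ≡ M + d ⊎ M ≡ L + d →
    1 ≤ d → L ≤ B → M ≤ B → suc B * B < q → Walk x x (q * d)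
  multiple-walk {M = M} {d} {q} W (inj₁ refl) 1≤d _ M≤B large
    with α , suc β , _ , _ , combination≡
           ← positive-combination M d q 1≤d (≤-<-trans (*-mono-≤ (s≤s M≤B) M≤B) large) =
    subst (Walk _ _) combination≡ (pumped-walk W α β)
  multiple-walk {L = L} {d = d} {q} W (inj₂ refl) 1≤d L≤B _ large
    with suc α , β , _ , _ , combination≡
           ← positive-combination L d q 1≤d (≤-<-trans (*-mono-≤ (s≤s L≤B) L≤B) large) =
    subst (Walk _ _) (trans (+-comm (β * (L + d)) (suc α * L)) combination≡) (pumped-walk W β α)

  odd-winding⇒walk : ∀ {D j x ℓ} → Winding D j x x → Odd j → (∀ d e → d + 2 * e ≡ j → d ∣ ℓ) →
    suc (j * suc D) * (j * suc D) * j < ℓ → Walk x x ℓ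
  odd-winding⇒walk {D} {j} {x} {ℓ} R j-odd divisors large
    with d , e , d+2e≡f+b , gap ← balance-gap (Winding.balance R)
    with divides q ℓ≡q*d ← divisors d e (trans d+2e≡f+b (Winding.edges R)) =
    subst (Walk x x) (sym ℓ≡q*d) (multiple-walk walks gap 1≤d base≤ period≤ q-large)
    where
      open Winding R
      B = j * suc D
      d+2e≡j : d + 2 * e ≡ j
      d+2e≡j = trans d+2e≡f+b edges
      1≤d : 1 ≤ d
      1≤d = [ ≤-reflexive ∘ sym , (λ 2<d → ≤-trans {1} {2} {d} (s≤s z≤n) (<⇒≤ 2<d)) ]′
              (odd-minus-even d e d+2e≡j j-odd)
      q-large : suc B * B < q
      q-large = *-cancelʳ-< d (suc B * B) q (begin-strict
        suc B * B * d ≤⟨ *-monoʳ-≤ (suc B * B) (≤-trans (m≤m+n d (2 * e)) (≤-reflexive d+2e≡j)) ⟩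
        suc B * B * j <⟨ large ⟩
        ℓ             ≡⟨ ℓ≡q*d ⟩
        q * d         ∎)
        where open ≤-Reasoning

open Walks using (Winding; winding; paths⇒bridged; odd-winding⇒walk; walk⇒HasClosedDirWalk)

corollary2p7 : (k ℓ n : ℕ) → (H : OrientedGraph n) →
    7 ≤ k → (10 ^ 7) * (k ^ 6) ≤ ℓ → SmallestNonDivisorAbove2 k ℓ →
    (∀ (x y : Fin n) → ¬ (x ≡ y) → Σ ℕ λ m → m ≤ 64 * k × DirPath H m x y) →
    (Σ ℕ λ s → Odd s × s < k × HasUndirectedCycle H s) →
    HasClosedDirWalk H ℓ
corollary2p7 k ℓ n H _ ℓ-large smallest paths (s , s-odd , s<k , _ , c , adj , c₀≡cₛ , _) =
  walk⇒HasClosedDirWalk H (odd-winding⇒walk H around s-odd (same-parity∣ℓ smallest s-odd s<k)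
    (<-≤-trans (cycle-bound k s s<k) ℓ-large))
  where
    around : Winding H (64 * k) s (c zero) (c zero)
    around = subst (Winding H (64 * k) s (c zero)) (sym c₀≡cₛ) (winding H (paths⇒bridged H paths) s c adj)
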